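{- Let $(g(x),f(x))$ be a Riordan array and let $\phi(x)=\mathrm{Rev}\left(\frac{x^2}{f(x)}\right)$. Then the horizontal half $H$ of $(g(x),f(x))$ satisfies $$H=(g(\phi(x)),x)\cdot\left(\frac{x\phi'(x)}{\phi(x)},f(\phi(x))\right).$$
   Context: All power series are formal power series with complex coefficients. A Riordan array is a pair $(g(x),f(x))$ of power series with $g(0)\neq 0$, $f(0)=0$, $f'(0)\neq 0$; it is identified with the infinite lower triangular matrix $(t_{n,k})_{n,k\ge 0}$, $t_{n,k}=[x^n]g(x)f(x)^k$. The product is $(g,f)\cdot(u,v)=(g(x)u(f(x)),v(f(x)))$, which corresponds to matrix multiplication. $\mathrm{Rev}(h)$ denotes the compositional inverse of a power series $h$ with $h(0)=0$, $h'(0)\ne0$. The horizontal half of a Riordan array with matrix $(t_{n,k})$ is the matrix $H$ whose $(n,k)$ entry is $t_{2n,n+k}$. -}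

module Defs where

open import Level using (Level; _⊔_) renaming (suc to lsuc)
open import Data.Nat using (ℕ; zero; suc; _∸_)
open import Data.Product using (Σ; _×_)
open import Relation.Nullary using (¬_)
open import Algebra.Bundles using (CommutativeRing)

ringFromℕ : {c ℓ : Level} (R : CommutativeRing c ℓ) → ℕ → CommutativeRing.Carrier R
ringFromℕ R zero    = CommutativeRing.0# R
ringFromℕ R (suc n) = CommutativeRing._+_ R (CommutativeRing.1# R) (ringFromℕ R n)

record CharZeroField (c ℓ : Level) : Set (lsuc (c ⊔ ℓ)) where
  field
    cring : CommutativeRing c ℓ
  open CommutativeRing cring
  field
    0≉1      : ¬ (0# ≈ 1#)
    inverse  : ∀ x → ¬ (x ≈ 0#) → Σ Carrier (λ y → x * y ≈ 1#)
    charZero : ∀ n → ¬ (ringFromℕ cring (suc n) ≈ 0#)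

module Series {c ℓ : Level} (F : CharZeroField c ℓ) where
  open CommutativeRing (CharZeroField.cring F) public using (Carrier; _≈_; 0#; 1#)
  open CommutativeRing (CharZeroField.cring F) using (_+_; _*_)

  fromℕ : ℕ → Carrier
  fromℕ = ringFromℕ (CharZeroField.cring F)

  PS : Set c
  PS = ℕ → Carrier

  _≋_ : PS → PS → Set ℓ
  a ≋ b = ∀ n → a n ≈ b n

  sumTo : (ℕ → Carrier) → ℕ → Carrier
  sumTo t zero    = t zero
  sumTo t (suc n) = sumTo t n + t (suc n)

  one : PS
  one zero    = 1#
  one (suc _) = 0#

  X : PS
  X (suc zero) = 1#
  X _          = 0#

  X² : PS
  X² (suc (suc zero)) = 1#
  X² _                = 0#

  mul : PS → PS → PS
  mul a b n = sumTo (λ i → a i * b (n ∸ i)) n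

  pow : PS → ℕ → PS
  pow b zero    = one
  pow b (suc k) = mul b (pow b k)

  -- composition a(b(x)); meaningful when b 0 ≈ 0 (then [x^n] b^k = 0 for k > n)
  comp : PS → PS → PS
  comp a b n = sumTo (λ k → a k * pow b k n) n

  deriv : PS → PS
  deriv a n = fromℕ (suc n) * a (suc n)

  IsRiordan : PS → PS → Set ℓ
  IsRiordan g f = ¬ (g 0 ≈ 0#) × (f 0 ≈ 0#) × ¬ (f 1 ≈ 0#)

  riordanMatrix : PS → PS → ℕ → ℕ → Carrier
  riordanMatrix g f n k = mul g (pow f k) n

  -- product of infinite matrices whose left factor is lower triangular:
  -- (A B) n k = Σ_{j ≤ n} A n j * B j k  (terms with j > n vanish)
  lowerMatMul : (ℕ → ℕ → Carrier) → (ℕ → ℕ → Carrier) → ℕ → ℕ → Carrier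
  lowerMatMul A B n k = sumTo (λ j → A n j * B j k) n

module Submission where

-- Write f = x u and h = x s, so that s u = 1, and put w = s(φ) = x/φ, so q = w φ′. Column n + k of
-- (g, f) is g f^k · x^n u^n, hence t(2n, n+k) = Σ_{m ≤ n} [x^m](g f^k) · [x^(n-m)] u^n. Multiplying by
-- (g(φ), x) multiplies each column by g(φ), so the (n, k) entry of the product is
-- [x^n] g(φ) q f(φ)^k = [x^n] (g f^k)(φ) w φ′ = Σ_{m ≤ n} [x^m](g f^k) · [x^n] φ^m w φ′.
-- The two sums agree termwise by Lagrange inversion, [x^n] φ^m w φ′ = [x^(n-m)] u^n, which comes from
-- the change of variables [x^N] A(φ) φ′ w^(N+1) = [x^N] A, itself a consequence of the residue
-- computation [x^p] w^(p+1) φ′ = δ_{p,0}.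

open import Defs
open import Level using (Level)
open import Data.Nat as ℕ using (ℕ; zero; suc; _∸_; _≤_; _<_; z≤n; s≤s)
import Data.Nat.Properties as ℕₚ
open import Data.Product using (_,_)
open import Data.Sum using (inj₁; inj₂)
open import Relation.Binary.Definitions using (tri<; tri≈; tri>)
open import Relation.Binary.PropositionalEquality as ≡ using (_≡_)
open import Relation.Binary.Bundles using (Setoid)
open import Relation.Binary.Structures using (IsEquivalence)
open import Algebra.Bundles using (CommutativeRing; CommutativeMonoid)
import Algebra.Properties.CommutativeSemigroup as CommutativeSemigroupProperties
import Algebra.Properties.Ring as RingProperties
import Relation.Binary.Reasoning.Setoid as SetoidReasoning

module PowerSeriesAlgebra {c ℓ : Level} (F : CharZeroField c ℓ) where
  open Series F
  open CommutativeRing (CharZeroField.cring F) hiding (Carrier; _≈_; 0#; 1#)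
  open CommutativeSemigroupProperties +-commutativeSemigroup using () renaming (interchange to +-interchange)
  open RingProperties ring using (+-identityʳ-unique)
  module ≈-Reasoning = SetoidReasoning setoid

  sumTo-cong : ∀ {t s : ℕ → Carrier} n → (∀ i → i ≤ n → t i ≈ s i) → sumTo t n ≈ sumTo s n
  sumTo-cong zero    t≈s = t≈s 0 z≤n
  sumTo-cong (suc n) t≈s =
    +-cong (sumTo-cong n (λ i i≤n → t≈s i (ℕₚ.m≤n⇒m≤1+n i≤n))) (t≈s (suc n) ℕₚ.≤-refl)

  sumTo-+ : ∀ (t s : ℕ → Carrier) n → sumTo (λ i → t i + s i) n ≈ sumTo t n + sumTo s n
  sumTo-+ t s zero    = refl
  sumTo-+ t s (suc n) = trans (+-congʳ (sumTo-+ t s n)) (+-interchange _ _ _ _)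

  *-distribˡ-sumTo : ∀ a (t : ℕ → Carrier) n → a * sumTo t n ≈ sumTo (λ i → a * t i) n
  *-distribˡ-sumTo a t zero    = refl
  *-distribˡ-sumTo a t (suc n) = trans (distribˡ a (sumTo t n) (t (suc n))) (+-congʳ (*-distribˡ-sumTo a t n))

  *-distribʳ-sumTo : ∀ a (t : ℕ → Carrier) n → sumTo t n * a ≈ sumTo (λ i → t i * a) n
  *-distribʳ-sumTo a t zero    = refl
  *-distribʳ-sumTo a t (suc n) = trans (distribʳ a (sumTo t n) (t (suc n))) (+-congʳ (*-distribʳ-sumTo a t n))

  sumTo-zero : ∀ (t : ℕ → Carrier) n → (∀ i → i ≤ n → t i ≈ 0#) → sumTo t n ≈ 0#
  sumTo-zero t n t≈0 = trans (sumTo-cong n t≈0) (zeros n)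
    where
    zeros : ∀ n → sumTo (λ _ → 0#) n ≈ 0#
    zeros zero    = refl
    zeros (suc n) = trans (+-identityʳ _) (zeros n)

  sumTo-unfoldˡ : ∀ (t : ℕ → Carrier) n → sumTo t (suc n) ≈ t 0 + sumTo (λ i → t (suc i)) n
  sumTo-unfoldˡ t zero    = refl
  sumTo-unfoldˡ t (suc n) = trans (+-congʳ (sumTo-unfoldˡ t n)) (+-assoc _ _ _)

  sumTo-head : ∀ (t : ℕ → Carrier) n → (∀ i → t (suc i) ≈ 0#) → sumTo t n ≈ t 0
  sumTo-head t zero    _   = refl
  sumTo-head t (suc n) t≈0 = begin
    sumTo t (suc n)                     ≈⟨ sumTo-unfoldˡ t n ⟩
    t 0 + sumTo (λ i → t (suc i)) n     ≈⟨ +-congˡ (sumTo-zero _ n (λ i _ → t≈0 i)) ⟩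
    t 0 + 0#                            ≈⟨ +-identityʳ _ ⟩
    t 0                                 ∎
    where open ≈-Reasoning

  sumTo-extend : ∀ (t : ℕ → Carrier) {n} m → n ≤ m → (∀ i → n < i → i ≤ m → t i ≈ 0#) →
                 sumTo t n ≈ sumTo t m
  sumTo-extend t zero    z≤n  _   = refl
  sumTo-extend t {n} (suc m) n≤1+m t≈0 with ℕₚ.m≤n⇒m<n∨m≡n n≤1+m
  ... | inj₂ ≡.refl      = refl
  ... | inj₁ (s≤s n≤m) = begin
    sumTo t n                ≈⟨ sumTo-extend t m n≤m (λ i n<i i≤m → t≈0 i n<i (ℕₚ.m≤n⇒m≤1+n i≤m)) ⟩
    sumTo t m                ≈⟨ +-identityʳ _ ⟨
    sumTo t m + 0#           ≈⟨ +-congˡ (t≈0 (suc m) (s≤s n≤m) ℕₚ.≤-refl) ⟨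
    sumTo t (suc m)          ∎
    where open ≈-Reasoning

  sumTo-reverse : ∀ (t : ℕ → Carrier) n → sumTo t n ≈ sumTo (λ i → t (n ∸ i)) n
  sumTo-reverse t zero    = refl
  sumTo-reverse t (suc n) = begin
    sumTo t (suc n)                              ≈⟨ sumTo-unfoldˡ t n ⟩
    t 0 + sumTo (λ i → t (suc i)) n              ≈⟨ +-congˡ (sumTo-reverse (λ i → t (suc i)) n) ⟩
    t 0 + sumTo (λ i → t (suc (n ∸ i))) n        ≈⟨ +-comm _ _ ⟩
    sumTo (λ i → t (suc (n ∸ i))) n + t 0
      ≈⟨ +-cong (sumTo-cong n (λ i i≤n → reflexive (≡.cong t (≡.sym (ℕₚ.+-∸-assoc 1 i≤n)))))
                (reflexive (≡.cong t (≡.sym (ℕₚ.n∸n≡0 n)))) ⟩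
    sumTo (λ i → t (suc n ∸ i)) (suc n)          ∎
    where open ≈-Reasoning

  sumTo-swap : ∀ (G : ℕ → ℕ → Carrier) n m →
    sumTo (λ i → sumTo (G i) m) n ≈ sumTo (λ j → sumTo (λ i → G i j) n) m
  sumTo-swap G zero    m = refl
  sumTo-swap G (suc n) m = trans (+-congʳ (sumTo-swap G n m)) (sym (sumTo-+ _ _ m))

  sumTo-triangle : ∀ (G : ℕ → ℕ → Carrier) n →
    sumTo (λ k → sumTo (λ i → G i k) k) n ≈ sumTo (λ i → sumTo (λ j → G i (i ℕ.+ j)) (n ∸ i)) n
  sumTo-triangle G zero    = refl
  sumTo-triangle G (suc n) = begin
    sumTo (λ k → sumTo (λ i → G i k) k) n + sumTo (λ i → G i (suc n)) (suc n)
      ≈⟨ +-congʳ (sumTo-triangle G n) ⟩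
    sumTo (λ i → row i (n ∸ i)) n + (sumTo (λ i → G i (suc n)) n + G (suc n) (suc n))
      ≈⟨ +-assoc _ _ _ ⟨
    sumTo (λ i → row i (n ∸ i)) n + sumTo (λ i → G i (suc n)) n + G (suc n) (suc n)
      ≈⟨ +-cong (trans (sym (sumTo-+ _ _ n)) (sumTo-cong n extendRow)) lastRow ⟩
    sumTo (λ i → row i (suc n ∸ i)) n + row (suc n) (n ∸ n)
      ∎
    where
    open ≈-Reasoning
    row : ℕ → ℕ → Carrier
    row i m = sumTo (λ j → G i (i ℕ.+ j)) m
    extendRow : ∀ i → i ≤ n → row i (n ∸ i) + G i (suc n) ≈ row i (suc n ∸ i)
    extendRow i i≤n rewrite ℕₚ.+-∸-assoc 1 i≤n =
      +-congˡ (reflexive (≡.cong (G i) (≡.sym (≡.trans (ℕₚ.+-suc i (n ∸ i))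
                                                      (≡.cong suc (ℕₚ.m+[n∸m]≡n i≤n))))))
    lastRow : G (suc n) (suc n) ≈ row (suc n) (n ∸ n)
    lastRow rewrite ℕₚ.n∸n≡0 n | ℕₚ.+-identityʳ n = refl

  ≋-isEquivalence : IsEquivalence _≋_
  ≋-isEquivalence = record
    { refl  = λ _ → refl
    ; sym   = λ a≋b n → sym (a≋b n)
    ; trans = λ a≋b b≋d n → trans (a≋b n) (b≋d n)
    }

  open IsEquivalence ≋-isEquivalence public
    using () renaming (refl to ≋-refl; sym to ≋-sym; trans to ≋-trans)

  ≋-setoid : Setoid c ℓ
  ≋-setoid = record { isEquivalence = ≋-isEquivalence }

  module ≋-Reasoning = SetoidReasoning ≋-setoid

  mul-cong : ∀ {a a′ b b′} → a ≋ a′ → b ≋ b′ → mul a b ≋ mul a′ b′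
  mul-cong a≋a′ b≋b′ n = sumTo-cong n (λ i _ → *-cong (a≋a′ i) (b≋b′ (n ∸ i)))

  mul-congˡ : ∀ {a a′} b → a ≋ a′ → mul a b ≋ mul a′ b
  mul-congˡ b a≋a′ = mul-cong a≋a′ (≋-refl {b})

  mul-congʳ : ∀ a {b b′} → b ≋ b′ → mul a b ≋ mul a b′
  mul-congʳ a = mul-cong (≋-refl {a})

  mul-comm : ∀ a b → mul a b ≋ mul b a
  mul-comm a b n = begin
    sumTo (λ i → a i * b (n ∸ i)) n              ≈⟨ sumTo-reverse _ n ⟩
    sumTo (λ i → a (n ∸ i) * b (n ∸ (n ∸ i))) n
      ≈⟨ sumTo-cong n (λ i i≤n → trans (*-comm _ _) (*-congʳ (reflexive (≡.cong b (ℕₚ.m∸[m∸n]≡n i≤n))))) ⟩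
    sumTo (λ i → b i * a (n ∸ i)) n              ∎
    where open ≈-Reasoning

  mul-assoc : ∀ a b d → mul (mul a b) d ≋ mul a (mul b d)
  mul-assoc a b d n = begin
    sumTo (λ k → sumTo (λ i → a i * b (k ∸ i)) k * d (n ∸ k)) n
      ≈⟨ sumTo-cong n (λ k _ → *-distribʳ-sumTo _ _ k) ⟩
    sumTo (λ k → sumTo (λ i → a i * b (k ∸ i) * d (n ∸ k)) k) n
      ≈⟨ sumTo-triangle (λ i k → a i * b (k ∸ i) * d (n ∸ k)) n ⟩
    sumTo (λ i → sumTo (λ j → a i * b ((i ℕ.+ j) ∸ i) * d (n ∸ (i ℕ.+ j))) (n ∸ i)) n
      ≈⟨ sumTo-cong n (λ i _ → sumTo-cong (n ∸ i) (λ j _ → trans (*-assoc _ _ _)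
           (*-congˡ (*-cong (reflexive (≡.cong b (ℕₚ.m+n∸m≡n i j)))
                            (reflexive (≡.cong d (≡.sym (ℕₚ.∸-+-assoc n i j)))))))) ⟩
    sumTo (λ i → sumTo (λ j → a i * (b j * d (n ∸ i ∸ j))) (n ∸ i)) n
      ≈⟨ sumTo-cong n (λ i _ → *-distribˡ-sumTo _ _ (n ∸ i)) ⟨
    sumTo (λ i → a i * sumTo (λ j → b j * d (n ∸ i ∸ j)) (n ∸ i)) n
      ∎
    where open ≈-Reasoning

  mul-identityˡ : ∀ a → mul one a ≋ a
  mul-identityˡ a n = trans (sumTo-head _ n (λ _ → zeroˡ _)) (*-identityˡ _)

  mul-identityʳ : ∀ a → mul a one ≋ a
  mul-identityʳ a = ≋-trans (mul-comm a one) (mul-identityˡ a)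

  mul-commutativeMonoid : CommutativeMonoid c ℓ
  mul-commutativeMonoid = record
    { Carrier = PS
    ; _≈_ = _≋_
    ; _∙_ = mul
    ; ε = one
    ; isCommutativeMonoid = record
      { isMonoid = record
        { isSemigroup = record
          { isMagma = record { isEquivalence = ≋-isEquivalence ; ∙-cong = mul-cong }
          ; assoc = mul-assoc
          }
        ; identity = mul-identityˡ , mul-identityʳ
        }
      ; comm = mul-comm
      }
    }

  open CommutativeSemigroupProperties (CommutativeMonoid.commutativeSemigroup mul-commutativeMonoid)
    using () renaming (interchange to mul-interchange)

  pow-cong : ∀ {a b} k → a ≋ b → pow a k ≋ pow b k
  pow-cong zero    _   = ≋-refl
  pow-cong (suc k) a≋b = mul-cong a≋b (pow-cong k a≋b)

  pow-+ : ∀ a i j → pow a (i ℕ.+ j) ≋ mul (pow a i) (pow a j)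
  pow-+ a zero    j = ≋-sym (mul-identityˡ (pow a j))
  pow-+ a (suc i) j = ≋-trans (mul-congʳ a (pow-+ a i j)) (≋-sym (mul-assoc a (pow a i) (pow a j)))

  pow-distrib-mul : ∀ a b k → pow (mul a b) k ≋ mul (pow a k) (pow b k)
  pow-distrib-mul a b zero    = ≋-sym (mul-identityˡ one)
  pow-distrib-mul a b (suc k) =
    ≋-trans (mul-congʳ (mul a b) (pow-distrib-mul a b k)) (mul-interchange a b (pow a k) (pow b k))

  pow-one : ∀ k → pow one k ≋ one
  pow-one zero    = ≋-refl
  pow-one (suc k) = ≋-trans (mul-identityˡ (pow one k)) (pow-one k)

  mul-X-zero : ∀ b → mul X b 0 ≈ 0#
  mul-X-zero b = zeroˡ _

  mul-X-suc : ∀ b m → mul X b (suc m) ≈ b m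
  mul-X-suc b m = begin
    mul X b (suc m)                                   ≈⟨ sumTo-unfoldˡ _ m ⟩
    0# * b (suc m) + sumTo (λ i → X (suc i) * b (m ∸ i)) m
      ≈⟨ +-cong (zeroˡ _) (sumTo-cong m (λ i _ → *-congʳ (X-suc i))) ⟩
    0# + mul one b m                                  ≈⟨ +-identityˡ _ ⟩
    mul one b m                                       ≈⟨ mul-identityˡ b m ⟩
    b m                                               ∎
    where
    open ≈-Reasoning
    X-suc : ∀ i → X (suc i) ≈ one i
    X-suc zero    = refl
    X-suc (suc i) = refl

  mul-X-cancel : ∀ a b → mul X a ≋ mul X b → a ≋ b
  mul-X-cancel a b Xa≋Xb m = trans (sym (mul-X-suc a m)) (trans (Xa≋Xb (suc m)) (mul-X-suc b m))

  mul-powX : ∀ j G N → j ≤ N → mul (pow X j) G N ≈ G (N ∸ j)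
  mul-powX zero    G N       _         = mul-identityˡ G N
  mul-powX (suc j) G (suc N) (s≤s j≤N) = begin
    mul (mul X (pow X j)) G (suc N)  ≈⟨ mul-assoc X (pow X j) G (suc N) ⟩
    mul X (mul (pow X j) G) (suc N)  ≈⟨ mul-X-suc (mul (pow X j) G) N ⟩
    mul (pow X j) G N                ≈⟨ mul-powX j G N j≤N ⟩
    G (N ∸ j)                        ∎
    where open ≈-Reasoning

  pow-X-2 : pow X 2 ≋ X²
  pow-X-2 zero                = mul-X-zero (pow X 1)
  pow-X-2 (suc zero)          = trans (mul-X-suc (pow X 1) 0) (mul-X-zero one)
  pow-X-2 (suc (suc zero))    = trans (mul-X-suc (pow X 1) 1) (mul-X-suc one 0)
  pow-X-2 (suc (suc (suc m))) = trans (mul-X-suc (pow X 1) (suc (suc m))) (mul-X-suc one (suc m))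

  divX : PS → PS
  divX a i = a (suc i)

  mul-X-divX : ∀ a → a 0 ≈ 0# → mul X (divX a) ≋ a
  mul-X-divX a a0≈0 zero    = trans (mul-X-zero (divX a)) (sym a0≈0)
  mul-X-divX a _    (suc m) = mul-X-suc (divX a) m

  mul-divX≋one : ∀ a b → a 0 ≈ 0# → b 0 ≈ 0# → mul a b ≋ X² → mul (divX a) (divX b) ≋ one
  mul-divX≋one a b a0≈0 b0≈0 ab≋X² = mul-X-cancel _ one (mul-X-cancel _ (mul X one) (begin
    mul X (mul X (mul (divX a) (divX b)))     ≈⟨ mul-assoc X X (mul (divX a) (divX b)) ⟨
    mul (mul X X) (mul (divX a) (divX b))     ≈⟨ mul-interchange X X (divX a) (divX b) ⟩
    mul (mul X (divX a)) (mul X (divX b))     ≈⟨ mul-cong (mul-X-divX a a0≈0) (mul-X-divX b b0≈0) ⟩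
    mul a b                                   ≈⟨ ab≋X² ⟩
    X²                                        ≈⟨ pow-X-2 ⟨
    mul X (mul X one)                         ∎))
    where open ≋-Reasoning

  mul-X-quotient : ∀ q d φ w → mul q φ ≋ mul X d → mul φ w ≋ X → q ≋ mul w d
  mul-X-quotient q d φ w qφ≋Xd φw≋X = mul-X-cancel q (mul w d) (begin
    mul X q               ≈⟨ mul-comm X q ⟩
    mul q X               ≈⟨ mul-congʳ q φw≋X ⟨
    mul q (mul φ w)       ≈⟨ mul-assoc q φ w ⟨
    mul (mul q φ) w       ≈⟨ mul-congˡ w qφ≋Xd ⟩
    mul (mul X d) w       ≈⟨ mul-assoc X d w ⟩
    mul X (mul d w)       ≈⟨ mul-congʳ X (mul-comm d w) ⟩
    mul X (mul w d)       ∎)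
    where open ≋-Reasoning

  mul-vanishes-below : ∀ a b r s → (∀ i → i < r → a i ≈ 0#) → (∀ j → j < s → b j ≈ 0#) →
                       ∀ n → n < r ℕ.+ s → mul a b n ≈ 0#
  mul-vanishes-below a b r s a≈0 b≈0 n n<r+s = sumTo-zero _ n term
    where
    b-factor≈0 : ∀ i → i ≤ n → r ≤ i → b (n ∸ i) * a i ≈ 0#
    b-factor≈0 i i≤n r≤i = trans (*-congʳ (b≈0 (n ∸ i) n∸i<s)) (zeroˡ _)
      where
      n∸i<s : n ∸ i < s
      n∸i<s = ℕₚ.+-cancelˡ-< i (n ∸ i) s
        (≡.subst (_< i ℕ.+ s) (≡.sym (ℕₚ.m+[n∸m]≡n i≤n))
                 (ℕₚ.<-≤-trans n<r+s (ℕₚ.+-monoˡ-≤ s r≤i)))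
    term : ∀ i → i ≤ n → a i * b (n ∸ i) ≈ 0#
    term i i≤n with ℕₚ.<-cmp i r
    ... | tri< i<r _ _  = trans (*-congʳ (a≈0 i i<r)) (zeroˡ _)
    ... | tri≈ _ i≡r _  = trans (*-comm _ _) (b-factor≈0 i i≤n (ℕₚ.≤-reflexive (≡.sym i≡r)))
    ... | tri> _ _ r<i  = trans (*-comm _ _) (b-factor≈0 i i≤n (ℕₚ.<⇒≤ r<i))

  pow-vanishes-below : ∀ φ → φ 0 ≈ 0# → ∀ k n → n < k → pow φ k n ≈ 0#
  pow-vanishes-below φ φ0≈0 (suc k) n n<1+k =
    mul-vanishes-below φ (pow φ k) 1 k (λ { zero _ → φ0≈0 ; (suc _) (s≤s ()) })
                       (pow-vanishes-below φ φ0≈0 k) n n<1+k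

  comp≋X⇒zero : ∀ h φ → comp h φ ≋ X → h 0 ≈ 0#
  comp≋X⇒zero h φ h∘φ≋X = trans (sym (*-identityʳ (h 0))) (h∘φ≋X 0)

  module Composition (φ : PS) (φ0≈0 : φ 0 ≈ 0#) where

    comp-extend : ∀ a N M → N ≤ M → comp a φ N ≈ sumTo (λ k → a k * pow φ k N) M
    comp-extend a N M N≤M =
      sumTo-extend _ M N≤M (λ k N<k _ → trans (*-congˡ (pow-vanishes-below φ φ0≈0 k N N<k)) (zeroʳ _))

    mul-comp-coeff : ∀ a b N → mul (comp a φ) b N ≈ sumTo (λ j → a j * mul (pow φ j) b N) N
    mul-comp-coeff a b N = begin
      sumTo (λ i → comp a φ i * b (N ∸ i)) N
        ≈⟨ sumTo-cong N (λ i i≤N → *-congʳ (comp-extend a i N i≤N)) ⟩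
      sumTo (λ i → sumTo (λ j → a j * pow φ j i) N * b (N ∸ i)) N
        ≈⟨ sumTo-cong N (λ i _ → *-distribʳ-sumTo _ _ N) ⟩
      sumTo (λ i → sumTo (λ j → a j * pow φ j i * b (N ∸ i)) N) N
        ≈⟨ sumTo-swap (λ i j → a j * pow φ j i * b (N ∸ i)) N N ⟩
      sumTo (λ j → sumTo (λ i → a j * pow φ j i * b (N ∸ i)) N) N
        ≈⟨ sumTo-cong N (λ j _ → trans (sumTo-cong N (λ i _ → *-assoc _ _ _)) (sym (*-distribˡ-sumTo _ _ N))) ⟩
      sumTo (λ j → a j * mul (pow φ j) b N) N
        ∎
      where open ≈-Reasoning

    comp-cong : ∀ {a a′} → a ≋ a′ → comp a φ ≋ comp a′ φ
    comp-cong a≋a′ N = sumTo-cong N (λ k _ → *-congʳ (a≋a′ k))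

    comp-mul : ∀ a b → comp (mul a b) φ ≋ mul (comp a φ) (comp b φ)
    comp-mul a b N = begin
      sumTo (λ k → mul a b k * pow φ k N) N
        ≈⟨ sumTo-cong N (λ k _ → *-distribʳ-sumTo _ _ k) ⟩
      sumTo (λ k → sumTo (λ i → a i * b (k ∸ i) * pow φ k N) k) N
        ≈⟨ sumTo-triangle (λ i k → a i * b (k ∸ i) * pow φ k N) N ⟩
      sumTo (λ i → sumTo (λ j → a i * b (i ℕ.+ j ∸ i) * pow φ (i ℕ.+ j) N) (N ∸ i)) N
        ≈⟨ sumTo-cong N (λ i _ → sumTo-extend _ N (ℕₚ.m∸n≤m N i) (λ j N∸i<j _ →
             trans (*-congˡ (pow-vanishes-below φ φ0≈0 (i ℕ.+ j) N (N<i+j i j N∸i<j))) (zeroʳ _))) ⟩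
      sumTo (λ i → sumTo (λ j → a i * b (i ℕ.+ j ∸ i) * pow φ (i ℕ.+ j) N) N) N
        ≈⟨ sumTo-cong N (λ i _ → trans (sumTo-cong N (λ j _ → trans (*-assoc _ _ _)
              (*-congˡ (*-cong (reflexive (≡.cong b (ℕₚ.m+n∸m≡n i j)))
                               (trans (pow-+ φ i j N) (mul-comm (pow φ i) (pow φ j) N))))))
              (sym (*-distribˡ-sumTo _ _ N))) ⟩
      sumTo (λ i → a i * sumTo (λ j → b j * mul (pow φ j) (pow φ i) N) N) N
        ≈⟨ sumTo-cong N (λ i _ → *-congˡ
             (trans (mul-comm (pow φ i) (comp b φ) N) (mul-comp-coeff b (pow φ i) N))) ⟨
      sumTo (λ i → a i * mul (pow φ i) (comp b φ) N) N
        ≈⟨ mul-comp-coeff a (comp b φ) N ⟨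
      mul (comp a φ) (comp b φ) N
        ∎
      where
      open ≈-Reasoning
      N<i+j : ∀ i j → N ∸ i < j → N < i ℕ.+ j
      N<i+j i j N∸i<j = ℕₚ.≤-<-trans (ℕₚ.m≤n+m∸n N i) (ℕₚ.+-monoʳ-< i N∸i<j)

    comp-one : comp one φ ≋ one
    comp-one N = trans (sumTo-head _ N (λ _ → zeroˡ _)) (*-identityˡ _)

    comp-pow : ∀ a k → comp (pow a k) φ ≋ pow (comp a φ) k
    comp-pow a zero    = comp-one
    comp-pow a (suc k) = ≋-trans (comp-mul a (pow a k)) (mul-congʳ (comp a φ) (comp-pow a k))

    comp-X : comp X φ ≋ φ
    comp-X zero    = trans (zeroˡ _) (sym φ0≈0)
    comp-X (suc M) = begin
      comp X φ (suc M)                                              ≈⟨ sumTo-unfoldˡ _ M ⟩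
      0# * one (suc M) + sumTo (λ k → X (suc k) * pow φ (suc k) (suc M)) M
        ≈⟨ +-cong (zeroˡ _) (sumTo-head _ M (λ _ → zeroˡ _)) ⟩
      0# + 1# * mul φ one (suc M)                                   ≈⟨ trans (+-identityˡ _) (*-identityˡ _) ⟩
      mul φ one (suc M)                                             ≈⟨ mul-identityʳ φ (suc M) ⟩
      φ (suc M)                                                     ∎
      where open ≈-Reasoning

    comp-mul-X : ∀ a → comp (mul X a) φ ≋ mul φ (comp a φ)
    comp-mul-X a = ≋-trans (comp-mul X a) (mul-congˡ (comp a φ) comp-X)

    comp-mul-pow : ∀ g f q k →
                   mul (comp g φ) (mul q (pow (comp f φ) k)) ≋ mul (comp (mul g (pow f k)) φ) q
    comp-mul-pow g f q k = begin
      mul (comp g φ) (mul q (pow (comp f φ) k))  ≈⟨ mul-congʳ (comp g φ) (mul-comm q (pow (comp f φ) k)) ⟩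
      mul (comp g φ) (mul (pow (comp f φ) k) q)  ≈⟨ mul-assoc (comp g φ) (pow (comp f φ) k) q ⟨
      mul (mul (comp g φ) (pow (comp f φ) k)) q  ≈⟨ mul-congˡ q (mul-congʳ (comp g φ) (comp-pow f k)) ⟨
      mul (mul (comp g φ) (comp (pow f k) φ)) q  ≈⟨ mul-congˡ q (comp-mul g (pow f k)) ⟨
      mul (comp (mul g (pow f k)) φ) q           ∎
      where open ≋-Reasoning

  add : PS → PS → PS
  add a b n = a n + b n

  scale : Carrier → PS → PS
  scale k a n = k * a n

  add-cong : ∀ {a a′ b b′} → a ≋ a′ → b ≋ b′ → add a b ≋ add a′ b′
  add-cong a≋a′ b≋b′ n = +-cong (a≋a′ n) (b≋b′ n)

  add-comm : ∀ a b → add a b ≋ add b a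
  add-comm a b n = +-comm (a n) (b n)

  scale-cong : ∀ k {a a′} → a ≋ a′ → scale k a ≋ scale k a′
  scale-cong k a≋a′ n = *-congˡ (a≋a′ n)

  scale-distrib-add : ∀ k a b → scale k (add a b) ≋ add (scale k a) (scale k b)
  scale-distrib-add k a b n = distribˡ k (a n) (b n)

  mul-distribˡ-add : ∀ a b d → mul a (add b d) ≋ add (mul a b) (mul a d)
  mul-distribˡ-add a b d n = trans (sumTo-cong n (λ _ _ → distribˡ _ _ _)) (sumTo-+ _ _ n)

  mul-scaleʳ : ∀ a k b → mul a (scale k b) ≋ scale k (mul a b)
  mul-scaleʳ a k b n =
    trans (sumTo-cong n (λ _ _ → trans (sym (*-assoc _ _ _)) (trans (*-congʳ (*-comm _ _)) (*-assoc _ _ _))))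
          (sym (*-distribˡ-sumTo k _ n))

  fromℕ-+ : ∀ m n → fromℕ (m ℕ.+ n) ≈ fromℕ m + fromℕ n
  fromℕ-+ zero    n = sym (+-identityˡ _)
  fromℕ-+ (suc m) n = trans (+-congˡ (fromℕ-+ m n)) (sym (+-assoc _ _ _))

  deriv-cong : ∀ {a a′} → a ≋ a′ → deriv a ≋ deriv a′
  deriv-cong a≋a′ n = *-congˡ (a≋a′ (suc n))

  deriv-mul : ∀ a b → deriv (mul a b) ≋ add (mul (deriv a) b) (mul a (deriv b))
  deriv-mul a b n = begin
    fromℕ (suc n) * sumTo T (suc n)                          ≈⟨ *-distribˡ-sumTo _ T (suc n) ⟩
    sumTo (λ i → fromℕ (suc n) * T i) (suc n)               ≈⟨ sumTo-cong (suc n) splitWeight ⟩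
    sumTo (λ i → fromℕ i * T i + fromℕ (suc n ∸ i) * T i) (suc n)
                                                             ≈⟨ sumTo-+ _ _ (suc n) ⟩
    sumTo (λ i → fromℕ i * T i) (suc n) + sumTo (λ i → fromℕ (suc n ∸ i) * T i) (suc n)
                                                             ≈⟨ +-cong derivˡ derivʳ ⟩
    mul (deriv a) b n + mul a (deriv b) n                    ∎
    where
    open ≈-Reasoning
    T : ℕ → Carrier
    T i = a i * b (suc n ∸ i)
    splitWeight : ∀ i → i ≤ suc n → fromℕ (suc n) * T i ≈ fromℕ i * T i + fromℕ (suc n ∸ i) * T i
    splitWeight i i≤ = trans (*-congʳ (trans (reflexive (≡.cong fromℕ (≡.sym (ℕₚ.m+[n∸m]≡n i≤))))
                                              (fromℕ-+ i (suc n ∸ i))))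
                             (distribʳ _ _ _)
    derivˡ : sumTo (λ i → fromℕ i * T i) (suc n) ≈ mul (deriv a) b n
    derivˡ = begin
      sumTo (λ i → fromℕ i * T i) (suc n)                        ≈⟨ sumTo-unfoldˡ _ n ⟩
      0# * T 0 + sumTo (λ i → fromℕ (suc i) * T (suc i)) n
        ≈⟨ +-cong (zeroˡ _) (sumTo-cong n (λ _ _ → sym (*-assoc _ _ _))) ⟩
      0# + mul (deriv a) b n                                     ≈⟨ +-identityˡ _ ⟩
      mul (deriv a) b n                                          ∎
    derivʳ : sumTo (λ i → fromℕ (suc n ∸ i) * T i) (suc n) ≈ mul a (deriv b) n
    derivʳ = begin
      sumTo (λ i → fromℕ (suc n ∸ i) * T i) n + fromℕ (n ∸ n) * T (suc n)
        ≈⟨ +-cong (sumTo-cong n weightInside)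
                  (trans (*-congʳ (reflexive (≡.cong fromℕ (ℕₚ.n∸n≡0 n)))) (zeroˡ _)) ⟩
      mul a (deriv b) n + 0#                                     ≈⟨ +-identityʳ _ ⟩
      mul a (deriv b) n                                          ∎
      where
      weightInside : ∀ i → i ≤ n → fromℕ (suc n ∸ i) * T i ≈ a i * deriv b (n ∸ i)
      weightInside i i≤n rewrite ℕₚ.+-∸-assoc 1 i≤n =
        trans (sym (*-assoc _ _ _)) (trans (*-congʳ (*-comm _ _)) (*-assoc _ _ _))

  deriv-X : deriv X ≋ one
  deriv-X zero    = trans (*-identityʳ _) (+-identityʳ _)
  deriv-X (suc n) = zeroʳ _

  deriv-pow : ∀ w r → deriv (pow w (suc r)) ≋ scale (fromℕ (suc r)) (mul (pow w r) (deriv w))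
  deriv-pow w zero n = begin
    deriv (mul w one) n              ≈⟨ deriv-cong (mul-identityʳ w) n ⟩
    deriv w n                        ≈⟨ mul-identityˡ (deriv w) n ⟨
    mul one (deriv w) n              ≈⟨ *-identityˡ _ ⟨
    1# * mul one (deriv w) n         ≈⟨ *-congʳ (+-identityʳ 1#) ⟨
    (1# + 0#) * mul one (deriv w) n  ∎
    where open ≈-Reasoning
  deriv-pow w (suc r) n = begin
    deriv (mul w P) n                        ≈⟨ deriv-mul w P n ⟩
    mul (deriv w) P n + mul w (deriv P) n    ≈⟨ +-cong (mul-comm (deriv w) P n) wDP≈kPw′ ⟩
    mul P (deriv w) n + k * mul P (deriv w) n
      ≈⟨ trans (+-congʳ (sym (*-identityˡ _))) (sym (distribʳ _ _ _)) ⟩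
    (1# + k) * mul P (deriv w) n             ∎
    where
    open ≈-Reasoning
    P = pow w (suc r)
    k = fromℕ (suc r)
    wDP≈kPw′ : mul w (deriv P) n ≈ k * mul P (deriv w) n
    wDP≈kPw′ = begin
      mul w (deriv P) n                                 ≈⟨ mul-congʳ w (deriv-pow w r) n ⟩
      mul w (scale k (mul (pow w r) (deriv w))) n       ≈⟨ mul-scaleʳ w k (mul (pow w r) (deriv w)) n ⟩
      k * mul w (mul (pow w r) (deriv w)) n             ≈⟨ *-congˡ (mul-assoc w (pow w r) (deriv w) n) ⟨
      k * mul P (deriv w) n                             ∎

  fromℕ-suc-*-cancel : ∀ r x → fromℕ (suc r) * x ≈ 0# → x ≈ 0#
  fromℕ-suc-*-cancel r x kx≈0
    with CharZeroField.inverse F (fromℕ (suc r)) (CharZeroField.charZero F r)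
  ... | y , ky≈1 = begin
    x                        ≈⟨ *-identityˡ x ⟨
    1# * x                   ≈⟨ *-congʳ (trans (sym ky≈1) (*-comm _ _)) ⟩
    (y * fromℕ (suc r)) * x  ≈⟨ *-assoc _ _ _ ⟩
    y * (fromℕ (suc r) * x)  ≈⟨ *-congˡ kx≈0 ⟩
    y * 0#                   ≈⟨ zeroʳ y ⟩
    0#                       ∎
    where open ≈-Reasoning

  module LagrangeInversion (φ w : PS) (φ0≈0 : φ 0 ≈ 0#) (φw≋X : mul φ w ≋ X) where
    open Composition φ φ0≈0

    φ′ : PS
    φ′ = deriv φ

    deriv-φw : add (mul φ (deriv w)) (mul w φ′) ≋ one
    deriv-φw = begin
      add (mul φ (deriv w)) (mul w φ′)  ≈⟨ add-comm _ _ ⟩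
      add (mul w φ′) (mul φ (deriv w))  ≈⟨ add-cong (mul-comm w φ′) ≋-refl ⟩
      add (mul φ′ w) (mul φ (deriv w))  ≈⟨ deriv-mul φ w ⟨
      deriv (mul φ w)                   ≈⟨ deriv-cong φw≋X ⟩
      deriv X                           ≈⟨ deriv-X ⟩
      one                               ∎
      where open ≋-Reasoning

    X-deriv-pow : ∀ r → add (mul X (deriv (pow w (suc r))))
                            (scale (fromℕ (suc r)) (mul (pow w (suc (suc r))) φ′))
                        ≋ scale (fromℕ (suc r)) (pow w (suc r))
    X-deriv-pow r = begin
      add (mul X (deriv v)) (scale k (mul (mul w v) φ′))
        ≈⟨ add-cong X-deriv-v (scale-cong k (≋-trans (mul-congˡ φ′ (mul-comm w v)) (mul-assoc v w φ′))) ⟩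
      add (scale k (mul v (mul φ (deriv w)))) (scale k (mul v (mul w φ′)))
        ≈⟨ scale-distrib-add k (mul v (mul φ (deriv w))) (mul v (mul w φ′)) ⟨
      scale k (add (mul v (mul φ (deriv w))) (mul v (mul w φ′)))
        ≈⟨ scale-cong k (mul-distribˡ-add v (mul φ (deriv w)) (mul w φ′)) ⟨
      scale k (mul v (add (mul φ (deriv w)) (mul w φ′)))
        ≈⟨ scale-cong k (≋-trans (mul-congʳ v deriv-φw) (mul-identityʳ v)) ⟩
      scale k v
        ∎
      where
      open ≋-Reasoning
      v = pow w (suc r)
      k = fromℕ (suc r)
      X-deriv-v : mul X (deriv v) ≋ scale k (mul v (mul φ (deriv w)))
      X-deriv-v = begin
        mul X (deriv v)                                    ≈⟨ mul-congʳ X (deriv-pow w r) ⟩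
        mul X (scale k (mul (pow w r) (deriv w)))          ≈⟨ mul-scaleʳ X k (mul (pow w r) (deriv w)) ⟩
        scale k (mul X (mul (pow w r) (deriv w)))
          ≈⟨ scale-cong k (mul-congˡ (mul (pow w r) (deriv w)) (≋-trans (≋-sym φw≋X) (mul-comm φ w))) ⟩
        scale k (mul (mul w φ) (mul (pow w r) (deriv w)))
          ≈⟨ scale-cong k (mul-interchange w φ (pow w r) (deriv w)) ⟩
        scale k (mul v (mul φ (deriv w)))                  ∎

    -- [x^p] w^(p+1) φ′ is the residue of φ′/φ^(p+1); for p > 0 that is -1/p times the derivative
    -- of φ^(-p) = x^(-p) w^p, and a derivative has no x^(-1) term.
    residue : ∀ p → mul (pow w (suc p)) φ′ p ≈ one p
    residue zero = begin
      (w 0 * 1#) * ((1# + 0#) * φ 1)  ≈⟨ *-cong (*-identityʳ _) (trans (*-congʳ (+-identityʳ _)) (*-identityˡ _)) ⟩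
      w 0 * φ 1                       ≈⟨ *-comm _ _ ⟩
      φ 1 * w 0                       ≈⟨ +-identityˡ _ ⟨
      0# + φ 1 * w 0                  ≈⟨ +-congʳ (trans (*-congʳ φ0≈0) (zeroˡ _)) ⟨
      φ 0 * w 1 + φ 1 * w 0           ≈⟨ φw≋X 1 ⟩
      1#                              ∎
      where open ≈-Reasoning
    residue (suc r) = fromℕ-suc-*-cancel r _ (+-identityʳ-unique _ _
      (trans (+-congʳ (sym (mul-X-suc (deriv (pow w (suc r))) r))) (X-deriv-pow r (suc r))))

    pow-φ-mul-pow-w : ∀ j p → mul (pow φ j) (mul φ′ (mul (pow w j) (pow w (suc p))))
                              ≋ mul (pow X j) (mul (pow w (suc p)) φ′)
    pow-φ-mul-pow-w j p = begin
      mul (pow φ j) (mul φ′ (mul (pow w j) (pow w (suc p))))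
        ≈⟨ mul-congʳ (pow φ j) (≋-trans (mul-congʳ φ′ (mul-comm (pow w j) (pow w (suc p))))
                                           (≋-sym (mul-assoc φ′ (pow w (suc p)) (pow w j)))) ⟩
      mul (pow φ j) (mul (mul φ′ (pow w (suc p))) (pow w j))
        ≈⟨ mul-congʳ (pow φ j) (mul-comm _ _) ⟩
      mul (pow φ j) (mul (pow w j) (mul φ′ (pow w (suc p))))
        ≈⟨ mul-assoc (pow φ j) (pow w j) (mul φ′ (pow w (suc p))) ⟨
      mul (mul (pow φ j) (pow w j)) (mul φ′ (pow w (suc p)))
        ≈⟨ mul-cong (≋-trans (≋-sym (pow-distrib-mul φ w j)) (pow-cong j φw≋X)) (mul-comm φ′ _) ⟩
      mul (pow X j) (mul (pow w (suc p)) φ′)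
        ∎
      where open ≋-Reasoning

    pow-mul-residue : ∀ j N → j ≤ N → mul (pow φ j) (mul φ′ (pow w (suc N))) N ≈ one (N ∸ j)
    pow-mul-residue j N j≤N = begin
      mul (pow φ j) (mul φ′ (pow w (suc N))) N              ≈⟨ mul-congʳ (pow φ j) (mul-congʳ φ′ split) N ⟩
      mul (pow φ j) (mul φ′ (mul (pow w j) (pow w (suc p)))) N
                                                            ≈⟨ pow-φ-mul-pow-w j p N ⟩
      mul (pow X j) (mul (pow w (suc p)) φ′) N              ≈⟨ mul-powX j (mul (pow w (suc p)) φ′) N j≤N ⟩
      mul (pow w (suc p)) φ′ p                              ≈⟨ residue p ⟩
      one p                                                 ∎
      where
      open ≈-Reasoning
      p = N ∸ j
      split : pow w (suc N) ≋ mul (pow w j) (pow w (suc p))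
      split = ≡.subst (λ e → pow w e ≋ mul (pow w j) (pow w (suc p)))
                      (≡.trans (ℕₚ.+-suc j p) (≡.cong suc (ℕₚ.m+[n∸m]≡n j≤N))) (pow-+ w j (suc p))

    comp-change-of-variables : ∀ a N → mul (comp a φ) (mul φ′ (pow w (suc N))) N ≈ a N
    comp-change-of-variables a N = begin
      mul (comp a φ) (mul φ′ (pow w (suc N))) N                   ≈⟨ mul-comp-coeff a (mul φ′ (pow w (suc N))) N ⟩
      sumTo (λ j → a j * mul (pow φ j) (mul φ′ (pow w (suc N))) N) N
                                                                   ≈⟨ sumTo-cong N (λ j j≤N → *-congˡ (pow-mul-residue j N j≤N)) ⟩
      mul a one N                                                  ≈⟨ mul-identityʳ a N ⟩
      a N                                                          ∎
      where open ≈-Reasoning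

    module _ (u : PS) (Uw≈1 : mul (comp u φ) w ≋ one) where

      comp-powX-mul-pow : ∀ m n → mul (comp (mul (pow X m) (pow u n)) φ) (mul φ′ (pow w (suc n)))
                                  ≋ mul (pow φ m) (mul w φ′)
      comp-powX-mul-pow m n = begin
        mul (comp (mul (pow X m) (pow u n)) φ) (mul φ′ (mul w (pow w n)))
          ≈⟨ mul-cong (comp-mul (pow X m) (pow u n)) (mul-comm φ′ _) ⟩
        mul (mul (comp (pow X m) φ) (comp (pow u n) φ)) (mul (mul w (pow w n)) φ′)
          ≈⟨ mul-cong (mul-cong (≋-trans (comp-pow X m) (pow-cong m comp-X)) (comp-pow u n))
                      (≋-trans (mul-congˡ φ′ (mul-comm w _)) (mul-assoc _ w φ′)) ⟩
        mul (mul (pow φ m) (pow U n)) (mul (pow w n) (mul w φ′))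
          ≈⟨ mul-assoc (pow φ m) (pow U n) (mul (pow w n) (mul w φ′)) ⟩
        mul (pow φ m) (mul (pow U n) (mul (pow w n) (mul w φ′)))
          ≈⟨ mul-congʳ (pow φ m) (mul-assoc (pow U n) (pow w n) (mul w φ′)) ⟨
        mul (pow φ m) (mul (mul (pow U n) (pow w n)) (mul w φ′))
          ≈⟨ mul-congʳ (pow φ m) (mul-congˡ (mul w φ′) (≋-trans (≋-sym (pow-distrib-mul U w n))
                                                       (≋-trans (pow-cong n Uw≈1) (pow-one n)))) ⟩
        mul (pow φ m) (mul one (mul w φ′))
          ≈⟨ mul-congʳ (pow φ m) (mul-identityˡ (mul w φ′)) ⟩
        mul (pow φ m) (mul w φ′)
          ∎
        where
        open ≋-Reasoning
        U = comp u φ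

      lagrange-inversion : ∀ m n → m ≤ n → mul (pow φ m) (mul w φ′) n ≈ pow u n (n ∸ m)
      lagrange-inversion m n m≤n = begin
        mul (pow φ m) (mul w φ′) n                                      ≈⟨ comp-powX-mul-pow m n n ⟨
        mul (comp (mul (pow X m) (pow u n)) φ) (mul φ′ (pow w (suc n))) n  ≈⟨ comp-change-of-variables _ n ⟩
        mul (pow X m) (pow u n) n                                       ≈⟨ mul-powX m (pow u n) n m≤n ⟩
        pow u n (n ∸ m)                                                 ∎
        where open ≈-Reasoning

  lowerMatMul-riordan-X : ∀ G (B : ℕ → ℕ → Carrier) n k →
                          lowerMatMul (riordanMatrix G X) B n k ≈ mul G (λ j → B j k) n
  lowerMatMul-riordan-X G B n k = begin
    sumTo (λ j → mul G (pow X j) n * B j k) n      ≈⟨ sumTo-cong n (λ j j≤n → *-congʳ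
                                                       (trans (mul-comm G (pow X j) n) (mul-powX j G n j≤n))) ⟩
    sumTo (λ j → G (n ∸ j) * B j k) n              ≈⟨ sumTo-reverse _ n ⟩
    sumTo (λ j → G (n ∸ (n ∸ j)) * B (n ∸ j) k) n
      ≈⟨ sumTo-cong n (λ j j≤n → *-congʳ (reflexive (≡.cong G (ℕₚ.m∸[m∸n]≡n j≤n)))) ⟩
    mul G (λ j → B j k) n                          ∎
    where open ≈-Reasoning

  riordanMatrix-+ : ∀ g f N n k → riordanMatrix g f N (n ℕ.+ k) ≈ mul (mul g (pow f k)) (pow f n) N
  riordanMatrix-+ g f N n k = begin
    mul g (pow f (n ℕ.+ k)) N                ≈⟨ mul-congʳ g (≋-trans (pow-+ f n k) (mul-comm (pow f n) (pow f k))) N ⟩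
    mul g (mul (pow f k) (pow f n)) N        ≈⟨ mul-assoc g (pow f k) (pow f n) N ⟨
    mul (mul g (pow f k)) (pow f n) N        ∎
    where open ≈-Reasoning

  mul-pow-X-mul-diagonal : ∀ a u n →
                           mul a (pow (mul X u) n) (n ℕ.+ n) ≈ sumTo (λ m → a m * pow u n (n ∸ m)) n
  mul-pow-X-mul-diagonal a u n = begin
    mul a (pow (mul X u) n) (n ℕ.+ n)         ≈⟨ mul-congʳ a (pow-distrib-mul X u n) (n ℕ.+ n) ⟩
    mul a Xⁿuⁿ (n ℕ.+ n)                      ≈⟨ sumTo-extend _ (n ℕ.+ n) (ℕₚ.m≤m+n n n) beyond-n ⟨
    sumTo (λ m → a m * Xⁿuⁿ (n ℕ.+ n ∸ m)) n  ≈⟨ sumTo-cong n (λ m m≤n → *-congˡ (within-n m m≤n)) ⟩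
    sumTo (λ m → a m * pow u n (n ∸ m)) n     ∎
    where
    open ≈-Reasoning
    Xⁿuⁿ = mul (pow X n) (pow u n)
    Xⁿuⁿ-vanishes : ∀ i → i < n → Xⁿuⁿ i ≈ 0#
    Xⁿuⁿ-vanishes i i<n = mul-vanishes-below (pow X n) (pow u n) n 0 (pow-vanishes-below X refl n) (λ _ ())
                                             i (≡.subst (i <_) (≡.sym (ℕₚ.+-identityʳ n)) i<n)
    beyond-n : ∀ m → n < m → m ≤ n ℕ.+ n → a m * Xⁿuⁿ (n ℕ.+ n ∸ m) ≈ 0#
    beyond-n m n<m m≤2n = trans (*-congˡ (Xⁿuⁿ-vanishes (n ℕ.+ n ∸ m) 2n∸m<n)) (zeroʳ _)
      where
      2n∸m<n : n ℕ.+ n ∸ m < n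
      2n∸m<n = ℕₚ.+-cancelʳ-< m (n ℕ.+ n ∸ m) n
        (≡.subst (_< n ℕ.+ m) (≡.sym (ℕₚ.m∸n+n≡m m≤2n)) (ℕₚ.+-monoʳ-< n n<m))
    within-n : ∀ m → m ≤ n → Xⁿuⁿ (n ℕ.+ n ∸ m) ≈ pow u n (n ∸ m)
    within-n m m≤n rewrite ℕₚ.+-∸-assoc n m≤n =
      trans (mul-powX n (pow u n) (n ℕ.+ (n ∸ m)) (ℕₚ.m≤m+n n (n ∸ m)))
            (reflexive (≡.cong (pow u n) (ℕₚ.m+n∸m≡n n (n ∸ m))))

  horizontalHalf : ∀ g f φ q u w → φ 0 ≈ 0# → mul X u ≋ f → mul φ w ≋ X → mul (comp u φ) w ≋ one →
                   q ≋ mul w (deriv φ) → ∀ n k →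
                   riordanMatrix g f (2 ℕ.* n) (n ℕ.+ k)
                     ≈ lowerMatMul (riordanMatrix (comp g φ) X) (riordanMatrix q (comp f φ)) n k
  horizontalHalf g f φ q u w φ0≈0 Xu≋f φw≋X Uw≋1 q≋wφ′ n k = begin
    riordanMatrix g f (2 ℕ.* n) (n ℕ.+ k)
      ≈⟨ reflexive (≡.cong (λ N → riordanMatrix g f N (n ℕ.+ k)) 2n≡n+n) ⟩
    riordanMatrix g f (n ℕ.+ n) (n ℕ.+ k)
      ≈⟨ riordanMatrix-+ g f (n ℕ.+ n) n k ⟩
    mul a (pow f n) (n ℕ.+ n)
      ≈⟨ mul-congʳ a (pow-cong n Xu≋f) (n ℕ.+ n) ⟨
    mul a (pow (mul X u) n) (n ℕ.+ n)
      ≈⟨ mul-pow-X-mul-diagonal a u n ⟩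
    sumTo (λ m → a m * pow u n (n ∸ m)) n
      ≈⟨ sumTo-cong n (λ m m≤n → *-congˡ (lagrange-inversion u Uw≋1 m n m≤n)) ⟨
    sumTo (λ m → a m * mul (pow φ m) (mul w φ′) n) n
      ≈⟨ mul-comp-coeff a (mul w φ′) n ⟨
    mul (comp a φ) (mul w φ′) n
      ≈⟨ mul-congʳ (comp a φ) q≋wφ′ n ⟨
    mul (comp a φ) q n
      ≈⟨ comp-mul-pow g f q k n ⟨
    mul (comp g φ) (mul q (pow (comp f φ) k)) n
      ≈⟨ lowerMatMul-riordan-X (comp g φ) (riordanMatrix q (comp f φ)) n k ⟨
    lowerMatMul (riordanMatrix (comp g φ) X) (riordanMatrix q (comp f φ)) n k
      ∎
    where
    open ≈-Reasoning
    open Composition φ φ0≈0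
    open LagrangeInversion φ w φ0≈0 φw≋X
    a = mul g (pow f k)
    2n≡n+n : 2 ℕ.* n ≡ n ℕ.+ n
    2n≡n+n = ≡.cong (n ℕ.+_) (ℕₚ.+-identityʳ n)

open import Data.Nat using (_+_; _*_)

mainTheorem3 : {c ℓ : Level} (F : CharZeroField c ℓ) →
    let open Series F in
    (g f h φ q : PS) →
    IsRiordan g f →
    -- h = x² / f(x)
    mul h f ≋ X² →
    -- φ = Rev(h)
    φ 0 ≈ 0# → comp h φ ≋ X →
    -- q = x φ'(x) / φ(x)
    mul q φ ≋ mul X (deriv φ) →
    -- horizontal half H n k = t (2n) (n+k) equals (g(φ), x) · (q, f(φ))
    (n k : ℕ) →
    riordanMatrix g f (2 * n) (n + k)
      ≈ lowerMatMul (riordanMatrix (comp g φ) X) (riordanMatrix q (comp f φ)) n k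
mainTheorem3 F g f h φ q (_ , f0≈0 , _) hf≋X² φ0≈0 h∘φ≋X qφ≋Xφ′ =
  horizontalHalf g f φ q u w φ0≈0 Xu≋f φw≋X Uw≋1 q≋wφ′
  where
  open Series F
  open PowerSeriesAlgebra F
  open Composition φ φ0≈0
  s u w : PS
  s = divX h
  u = divX f
  w = comp s φ
  h0≈0 : h 0 ≈ 0#
  h0≈0 = comp≋X⇒zero h φ h∘φ≋X
  Xu≋f : mul X u ≋ f
  Xu≋f = mul-X-divX f f0≈0
  su≋1 : mul s u ≋ one
  su≋1 = mul-divX≋one h f h0≈0 f0≈0 hf≋X²
  φw≋X : mul φ w ≋ X
  φw≋X = ≋-trans (≋-sym (comp-mul-X s)) (≋-trans (comp-cong (mul-X-divX h h0≈0)) h∘φ≋X)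
  Uw≋1 : mul (comp u φ) w ≋ one
  Uw≋1 = ≋-trans (≋-sym (comp-mul u s)) (≋-trans (comp-cong (≋-trans (mul-comm u s) su≋1)) comp-one)
  q≋wφ′ : q ≋ mul w (deriv φ)
  q≋wφ′ = mul-X-quotient q (deriv φ) φ w qφ≋Xφ′ φw≋X
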